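{- Let $P$ be a finite poset and consider Frank's network of $P$. Suppose a flow $f$ and a potential $\pi$, of values $v$ and $p=\pi(t)$, satisfy (i) $0\le\pi(z)\le p$ for all vertices $z$; (ii) for every edge $(z,w)$, $f(z,w)=1\Rightarrow\pi(w)-\pi(z)\ge a(z,w)$; (iii) for every edge $(z,w)$, $f(z,w)=0\Rightarrow\pi(w)-\pi(z)\le a(z,w)$. Run the following reverse minimal cost flow algorithm from $(f,\pi)$. Step 1: let $G'$ be the directed graph on the same vertices with edges $(z,w)$ for each network edge $(z,w)$ with $\pi(w)-\pi(z)=a(z,w)$ and $f(z,w)>0$, and edges $(w,z)$ for each network edge $(z,w)$ with $\pi(w)-\pi(z)=a(z,w)$ and $f(z,w)<c(z,w)$; let $X$ be the set of vertices reachable from $s$ in $G'$. Step 2a (if $t\in X$): choose a path $\mathcal{M}$ from $s$ to $t$ in $G'$ and decrease the flow by $1$ along it (decreasing $f$ by 1 on network edges traversed forward and increasing $f$ by 1 on network edges traversed backward); decrease $v$ by $1$. Step 2b (if $t\notin X$): decrease $\pi(z)$ by $1$ for every vertex $z\notin X$, decrease $p$ by $1$, then reset any potential equal to $-1$ to $0$ and any potential equal to $p+1$ to $p$. Step 3: if $p>0$ and $v>0$, return to Step 1; otherwise stop. Then at every stage $(p,v)$ of this algorithm, the current flow and potential satisfy conditions (i)–(iii) (with the current value $p$).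
   Context: Frank's network of a finite poset $P$: vertex set $\{s,t\}\cup\{x_q:q\in P\}\cup\{y_q:q\in P\}$; directed edges $(s,x_q)$ and $(y_q,t)$ for all $q\in P$, and $(x_q,y_{q'})$ for all $q,q'\in P$ with $q\ge q'$; all capacities $c(e)=1$; cost $a(e)=1$ if $e=(x_q,y_q)$ and $a(e)=0$ otherwise. A flow is an integer function $f$ on edges with $0\le f(e)\le c(e)$ satisfying conservation at all vertices other than $s,t$; its value $v$ is the total flow out of $s$. A potential is a function $\pi$ from vertices to nonnegative integers with $\pi(s)=0$; its value is $\pi(t)$. -}

module Defs where

open import Data.Nat using (ℕ; zero; suc; _+_; _∸_; _≤_; _<_; pred)
open import Data.Nat.Properties using () renaming (_≟_ to _≟ℕ_)
open import Data.Fin using (Fin) renaming (_≟_ to _≟F_)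
open import Data.List using (List; []; _∷_; _++_; map; allFin)
open import Data.Nat.ListAction using (sum)
open import Data.List.Relation.Unary.Unique.Propositional using (Unique)
open import Data.Product using (_×_; _,_)
open import Data.Sum using (_⊎_; inj₁; inj₂)
open import Data.Bool using (Bool; true; false; if_then_else_)
open import Function.Bundles using (_⇔_)
open import Relation.Nullary using (¬_; Dec; yes; no; does)
open import Relation.Binary.PropositionalEquality using (_≡_; _≢_; refl; cong)
open import Relation.Binary.Construct.Closure.ReflexiveTransitive using (Star; ε; _◅_)

module Frank (n : ℕ) (_≼_ : Fin n → Fin n → Set) where

  data V : Set where
    s t : V
    x y : Fin n → V

  x-inj : ∀ {q q'} → x q ≡ x q' → q ≡ q'
  x-inj refl = refl

  y-inj : ∀ {q q'} → y q ≡ y q' → q ≡ q'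
  y-inj refl = refl

  _≟V_ : (z w : V) → Dec (z ≡ w)
  s ≟V s = yes refl
  s ≟V t = no λ ()
  s ≟V x _ = no λ ()
  s ≟V y _ = no λ ()
  t ≟V s = no λ ()
  t ≟V t = yes refl
  t ≟V x _ = no λ ()
  t ≟V y _ = no λ ()
  x _ ≟V s = no λ ()
  x _ ≟V t = no λ ()
  x q ≟V x q' with q ≟F q'
  ... | yes refl = yes refl
  ... | no q≢q' = no λ e → q≢q' (x-inj e)
  x _ ≟V y _ = no λ ()
  y _ ≟V s = no λ ()
  y _ ≟V t = no λ ()
  y _ ≟V x _ = no λ ()
  y q ≟V y q' with q ≟F q'
  ... | yes refl = yes refl
  ... | no q≢q' = no λ e → q≢q' (y-inj e)

  allV : List V
  allV = s ∷ t ∷ map x (allFin n) ++ map y (allFin n)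

  data IsEdge : V → V → Set where
    sx : ∀ q → IsEdge s (x q)
    yt : ∀ q → IsEdge (y q) t
    xy : ∀ {q q'} → q' ≼ q → IsEdge (x q) (y q')

  -- capacity c(e) = 1 on every edge
  -- cost: a(x_q, y_q) = 1, otherwise 0
  a : V → V → ℕ
  a (x q) (y q') = if does (q ≟F q') then 1 else 0
  a _ _ = 0

  Flow : Set
  Flow = V → V → ℕ

  IsFlow : Flow → Set
  IsFlow f =
    (∀ z w → ¬ IsEdge z w → f z w ≡ 0) ×
    (∀ z w → IsEdge z w → f z w ≤ 1) ×
    (∀ z → z ≢ s → z ≢ t →
       sum (map (λ w → f w z) allV) ≡ sum (map (λ w → f z w) allV))

  value : Flow → ℕ
  value f = sum (map (λ q → f s (x q)) (allFin n))

  Potential : Set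
  Potential = V → ℕ

  IsPotential : Potential → Set
  IsPotential π = π s ≡ 0

  -- conditions (i)-(iii), with the current value p
  -- (π(w) - π(z) ≥ a  is written  π z + a ≤ π w, etc.; all quantities are ℕ)
  Conditions : Flow → Potential → ℕ → Set
  Conditions f π p =
    (∀ z → π z ≤ p) ×
    (∀ z w → IsEdge z w → f z w ≡ 1 → π z + a z w ≤ π w) ×
    (∀ z w → IsEdge z w → f z w ≡ 0 → π w ≤ π z + a z w)

  G' : Flow → Potential → V → V → Set
  G' f π z w =
    (IsEdge z w × π w ≡ π z + a z w × 0 < f z w) ⊎
    (IsEdge w z × π z ≡ π w + a w z × f w z < 1)

  vertices : ∀ {R : V → V → Set} {z u} → Star R z u → List V
  vertices {z = z} ε = z ∷ []
  vertices (_◅_ {i} _ p) = i ∷ vertices p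

  bump : Flow → V → V → (ℕ → ℕ) → Flow
  bump f z w g a' b' with a' ≟V z | b' ≟V w
  ... | yes _ | yes _ = g (f a' b')
  ... | _ | _ = f a' b'

  augment : ∀ {f π z u} → Flow → Star (G' f π) z u → Flow
  augment g ε = g
  augment g (_◅_ {i} {j} (inj₁ _) p) = augment (bump g i j pred) p
  augment g (_◅_ {i} {j} (inj₂ _) p) = augment (bump g j i suc) p

  -- reset: any potential equal to p+1 becomes p (the reset of -1 to 0 is
  -- realised by truncated subtraction _∸_ below)
  reset : ℕ → ℕ → ℕ
  reset p k = if does (k ≟ℕ suc p) then p else k

  -- Step 2b: X is (the characteristic function of) the set of vertices
  -- reachable from s in G'; the new p is p ∸ 1
  lower : (V → Bool) → Potential → ℕ → Potential
  lower X π p' z = reset p' (if X z then π z else π z ∸ 1)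

  record State : Set where
    constructor ⟨_,_,_,_⟩
    field
      flow : Flow
      pot  : Potential
      pval : ℕ
      vval : ℕ

  data Step : State → State → Set where
    step2a : ∀ {f π p v} → 0 < p → 0 < v →
             (M : Star (G' f π) s t) → Unique (vertices M) →
             Step ⟨ f , π , p , v ⟩ ⟨ augment f M , π , p , v ∸ 1 ⟩
    step2b : ∀ {f π p v} → 0 < p → 0 < v →
             (X : V → Bool) →
             (∀ z → (X z ≡ true) ⇔ Star (G' f π) s z) →
             X t ≡ false →
             Step ⟨ f , π , p , v ⟩ ⟨ f , lower X π (p ∸ 1) , p ∸ 1 , v ⟩

  Run : State → State → Set
  Run = Star Step

{-# OPTIONS --safe #-}
-- Both steps preserve a stronger invariant: (i)–(iii), π(s) = 0, π(t) = p, and f is supported on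
-- the edges and conserved.
--
-- Step 2a changes f only on edges of G', which are tight and so satisfy (ii) and (iii) whatever
-- the flow. Conservation survives because, part way along the path, the only imbalance is one
-- unit of missing inflow at the current vertex, which travels from s to t.
--
-- Step 2b takes π(z) − [z ∉ X] and clips it to [0, p − 1]. No edge of G' leaves X, so an edge
-- with flow from X to its complement, or an edge without flow from the complement into X, has
-- slack in (ii) resp. (iii) that absorbs the lowering. Clipping can only break (ii) on a costly
-- edge x_q → y_q carrying flow. That unit enters x_q from s and leaves y_q to t, so π(x_q) = 0
-- would put s → x_q into G' (hence x_q ∈ X), and π(y_q) = p with y_q ∈ X would put y_q → t
-- into G', contradicting t ∉ X.
module Submission where

open import Defs
open import Data.Bool using (Bool; true; false; if_then_else_)
open import Data.Empty using (⊥-elim)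
open import Data.Fin using (Fin)
open import Data.List using (List; _∷_; _++_; map; allFin)
open import Data.List.Membership.Propositional using (_∈_)
open import Data.List.Membership.Propositional.Properties
  using (∈-allFin; ∈-map⁺; ∈-map⁻; ∈-++⁺ˡ; ∈-++⁺ʳ)
open import Data.List.Properties using (map-cong; map-cong-local)
open import Data.List.Relation.Unary.All as All using (All; _∷_)
import Data.List.Relation.Unary.All.Properties as Allₚ
open import Data.List.Relation.Unary.AllPairs using (_∷_)
open import Data.List.Relation.Unary.Any using (Any; here; there; satisfied)
open import Data.List.Relation.Unary.Unique.Propositional using (Unique)
import Data.List.Relation.Unary.Unique.Propositional.Properties as Uniqueₚ
open import Data.Nat using (ℕ; zero; suc; _+_; _∸_; _⊓_; _≤_; _<_; pred; z<s; >-nonZero)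
open import Data.Nat.ListAction using (sum)
open import Data.Nat.Properties
open import Algebra.Properties.CommutativeSemigroup +-commutativeSemigroup using (xy∙z≈xz∙y)
open import Data.Product using (_×_; _,_; proj₁; proj₂)
open import Data.Sum as Sum using (_⊎_; inj₁; inj₂; [_,_]′)
open import Function using (id; _∘_; _$_; flip)
open import Function.Bundles using (_⇔_; Equivalence)
open import Relation.Nullary using (¬_; Dec; yes; no; does)
open import Relation.Binary.PropositionalEquality
open import Relation.Binary.Construct.Closure.ReflexiveTransitive using (Star; ε; _◅_; _◅◅_)
open import Relation.Binary.Structures using (IsPartialOrder)

module _ {A : Set} where

  sum-map-update : ∀ {φ φ' : A → ℕ} {i c d} {l : List A} → Unique l → i ∈ l →
                   φ' i + c ≡ φ i + d → (∀ w → w ≢ i → φ' w ≡ φ w) →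
                   sum (map φ' l) + c ≡ sum (map φ l) + d
  sum-map-update {φ} {φ'} {i} {c} {d} {_ ∷ l} (i∉l ∷ _) (here refl) at-i elsewhere = begin
    φ' i + sum (map φ' l) + c  ≡⟨ xy∙z≈xz∙y (φ' i) _ c ⟩
    φ' i + c + sum (map φ' l)  ≡⟨ cong₂ _+_ at-i rest-unchanged ⟩
    φ i + d + sum (map φ l)    ≡⟨ xy∙z≈xz∙y (φ i) _ d ⟨
    φ i + sum (map φ l) + d    ∎
    where
    open ≡-Reasoning
    rest-unchanged : sum (map φ' l) ≡ sum (map φ l)
    rest-unchanged = cong sum (map-cong-local (All.map (elsewhere _ ∘ ≢-sym) i∉l))
  sum-map-update {φ} {φ'} {i} {c} {d} {w ∷ l} (w∉l ∷ l!) (there i∈l) at-i elsewhere = begin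
    φ' w + sum (map φ' l) + c    ≡⟨ +-assoc (φ' w) _ c ⟩
    φ' w + (sum (map φ' l) + c)  ≡⟨ cong₂ _+_ (elsewhere w (All.lookup w∉l i∈l))
                                             (sum-map-update l! i∈l at-i elsewhere) ⟩
    φ w + (sum (map φ l) + d)    ≡⟨ +-assoc (φ w) _ d ⟨
    φ w + sum (map φ l) + d      ∎
    where open ≡-Reasoning

  sum-map-pos : ∀ {φ : A → ℕ} (l : List A) → 0 < sum (map φ l) → Any (λ w → 0 < φ w) l
  sum-map-pos {φ} (w ∷ l) pos with φ w in φw≡
  ... | zero  = there (sum-map-pos l pos)
  ... | suc _ = here (subst (0 <_) (sym φw≡) z<s)

  ∈⇒≤sum-map : ∀ {φ : A → ℕ} {i} {l : List A} → i ∈ l → φ i ≤ sum (map φ l)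
  ∈⇒≤sum-map {φ} {i} (here refl) = m≤m+n (φ i) _
  ∈⇒≤sum-map {φ} {l = w ∷ _} (there i∈l) = ≤-trans (∈⇒≤sum-map i∈l) (m≤n+m _ (φ w))

m+c≤n⇒m⊓p+c≤n⊓p : ∀ {m n c} p → m + c ≤ n → (0 < c → n ≤ p) → m ⊓ p + c ≤ n ⊓ p
m+c≤n⇒m⊓p+c≤n⊓p {m} {n} {zero} p m+0≤n _ = begin
  m ⊓ p + 0  ≡⟨ +-identityʳ _ ⟩
  m ⊓ p      ≤⟨ ⊓-monoˡ-≤ p (subst (_≤ n) (+-identityʳ m) m+0≤n) ⟩
  n ⊓ p      ∎
  where open ≤-Reasoning
m+c≤n⇒m⊓p+c≤n⊓p {m} {n} {suc c} p m+c≤n n≤p = begin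
  m ⊓ p + suc c  ≤⟨ +-monoˡ-≤ (suc c) (m⊓n≤m m p) ⟩
  m + suc c      ≤⟨ m+c≤n ⟩
  n              ≡⟨ m≤n⇒m⊓n≡m (n≤p z<s) ⟨
  n ⊓ p          ∎
  where open ≤-Reasoning

n≤m+c⇒n⊓p≤m⊓p+c : ∀ {m n c} p → n ≤ m + c → n ⊓ p ≤ m ⊓ p + c
n≤m+c⇒n⊓p≤m⊓p+c {m} {n} {c} p n≤m+c = begin
  n ⊓ p              ≤⟨ ⊓-mono-≤ n≤m+c (m≤m+n p c) ⟩
  (m + c) ⊓ (p + c)  ≡⟨ +-distribʳ-⊓ c m p ⟨
  m ⊓ p + c          ∎
  where open ≤-Reasoning

lowerUnless : Bool → ℕ → ℕ
lowerUnless b k = if b then k else k ∸ 1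

lowerUnless-≤ : ∀ b k → lowerUnless b k ≤ k
lowerUnless-≤ true  k = ≤-refl
lowerUnless-≤ false k = m∸n≤m k 1

lowerUnless-≤-pred : ∀ b {k p} → k ≤ suc p → (b ≡ true → k ≢ suc p) → lowerUnless b k ≤ p
lowerUnless-≤-pred true  k≤1+p k≢1+p = ≤-pred (≤∧≢⇒< k≤1+p (k≢1+p refl))
lowerUnless-≤-pred false k≤1+p _     = ∸-monoˡ-≤ 1 k≤1+p

lowerUnless-preserves-+≤ : ∀ bm bn {m n c} → m + c ≤ n →
                           (bm ≡ true → bn ≡ false → m + c < n) → (bm ≡ false → 0 < c → 0 < m) →
                           lowerUnless bm m + c ≤ lowerUnless bn n
lowerUnless-preserves-+≤ true  true  m+c≤n _ _ = m+c≤n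
lowerUnless-preserves-+≤ true  false _ m+c<n _ = ∸-monoˡ-≤ 1 (m+c<n refl refl)
lowerUnless-preserves-+≤ false true  {m} m+c≤n _ _ = ≤-trans (+-monoˡ-≤ _ (m∸n≤m m 1)) m+c≤n
lowerUnless-preserves-+≤ false false {m} {n} {zero} m+0≤n _ _ rewrite +-identityʳ m | +-identityʳ (m ∸ 1) =
  ∸-monoˡ-≤ 1 m+0≤n
lowerUnless-preserves-+≤ false false {zero} {c = suc _} _ _ m>0 with m>0 refl z<s
... | ()
lowerUnless-preserves-+≤ false false {suc m} {c = suc _} m+c<n _ _ = ∸-monoˡ-≤ 1 m+c<n

lowerUnless-preserves-≤+ : ∀ bm bn {m n c} → n ≤ m + c → (bn ≡ true → bm ≡ false → n < m + c) →
                           lowerUnless bn n ≤ lowerUnless bm m + c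
lowerUnless-preserves-≤+ true  true  n≤m+c _ = n≤m+c
lowerUnless-preserves-≤+ false true  {zero}  _ n<c = <⇒≤ (n<c refl refl)
lowerUnless-preserves-≤+ false true  {suc m} _ n<m+c = ≤-pred (n<m+c refl refl)
lowerUnless-preserves-≤+ true  false {n = n} n≤m+c _ = ≤-trans (m∸n≤m n 1) n≤m+c
lowerUnless-preserves-≤+ false false {zero} {n} n≤c _ = ≤-trans (m∸n≤m n 1) n≤c
lowerUnless-preserves-≤+ false false {suc m} n≤m+c _ = ∸-monoˡ-≤ 1 n≤m+c

module Invariance (n : ℕ) (_≼_ : Fin n → Fin n → Set) where
  open Frank n _≼_

  ∈-allV : ∀ z → z ∈ allV
  ∈-allV s     = here refl
  ∈-allV t     = there (here refl)
  ∈-allV (x q) = there (there (∈-++⁺ˡ (∈-map⁺ x (∈-allFin q))))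
  ∈-allV (y q) = there (there (∈-++⁺ʳ (map x (allFin n)) (∈-map⁺ y (∈-allFin q))))

  allV-unique : Unique allV
  allV-unique = ((λ ()) ∷ ≢-internal (λ ()) (λ ())) ∷ ≢-internal (λ ()) (λ ())
              ∷ Uniqueₚ.++⁺ (Uniqueₚ.map⁺ x-inj (Uniqueₚ.allFin⁺ n))
                            (Uniqueₚ.map⁺ y-inj (Uniqueₚ.allFin⁺ n)) x≢y
    where
    ≢-internal : ∀ {v} → (∀ {q} → v ≢ x q) → (∀ {q} → v ≢ y q) →
                 All (v ≢_) (map x (allFin n) ++ map y (allFin n))
    ≢-internal v≢x v≢y = Allₚ.++⁺ (Allₚ.map⁺ (All.universal (λ q → v≢x {q}) (allFin n)))
                                  (Allₚ.map⁺ (All.universal (λ q → v≢y {q}) (allFin n)))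
    x≢y : ∀ {v} → ¬ (v ∈ map x (allFin n) × v ∈ map y (allFin n))
    x≢y (v∈x , v∈y) with ∈-map⁻ x v∈x | ∈-map⁻ y v∈y
    ... | _ , _ , refl | _ , _ , ()

  sumV : (V → ℕ) → ℕ
  sumV φ = sum (map φ allV)

  outflow inflow : Flow → V → ℕ
  outflow g z = sumV (g z)
  inflow  g z = sumV (flip g z)

  Supported Conserved : Flow → Set
  Supported g = ∀ u v → ¬ IsEdge u v → g u v ≡ 0
  Conserved g = ∀ z → z ≢ s → z ≢ t → inflow g z ≡ outflow g z

  δ : V → V → ℕ
  δ z w with w ≟V z
  ... | yes _ = 1
  ... | no  _ = 0

  δ-≢ : ∀ {z w} → w ≢ z → δ z w ≡ 0
  δ-≢ {z} {w} w≢z with w ≟V z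
  ... | yes w≡z = ⊥-elim (w≢z w≡z)
  ... | no  _   = refl

  Deficit : Flow → V → Set
  Deficit g z = ∀ w → w ≢ s → w ≢ t → outflow g w ≡ inflow g w + δ z w

  Conserved⇒Deficit-s : ∀ {g} → Conserved g → Deficit g s
  Conserved⇒Deficit-s {g} conserved w w≢s w≢t = begin
    outflow g w            ≡⟨ conserved w w≢s w≢t ⟨
    inflow g w             ≡⟨ +-identityʳ _ ⟨
    inflow g w + 0         ≡⟨ cong (inflow g w +_) (δ-≢ w≢s) ⟨
    inflow g w + δ s w     ∎
    where open ≡-Reasoning

  Deficit-t⇒Conserved : ∀ {g} → Deficit g t → Conserved g
  Deficit-t⇒Conserved {g} deficit w w≢s w≢t = sym (begin
    outflow g w            ≡⟨ deficit w w≢s w≢t ⟩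
    inflow g w + δ t w     ≡⟨ cong (inflow g w +_) (δ-≢ w≢t) ⟩
    inflow g w + 0         ≡⟨ +-identityʳ _ ⟩
    inflow g w             ∎)
    where open ≡-Reasoning

  bump-≡ : ∀ g u v h → bump g u v h u v ≡ h (g u v)
  bump-≡ g u v h with u ≟V u | v ≟V v
  ... | yes _  | yes _  = refl
  ... | no u≢u | _      = ⊥-elim (u≢u refl)
  ... | yes _  | no v≢v = ⊥-elim (v≢v refl)

  bump-≢ : ∀ {g u v h z w} → z ≢ u ⊎ w ≢ v → bump g u v h z w ≡ g z w
  bump-≢ {u = u} {v} {z = z} {w} off with z ≟V u | w ≟V v
  ... | yes z≡u | yes w≡v = ⊥-elim ([ (_$ z≡u) , (_$ w≡v) ]′ off)
  ... | yes _   | no _    = refl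
  ... | no _    | _       = refl

  bump-cases : ∀ g u v h z w → bump g u v h z w ≡ g z w ⊎ (z ≡ u × w ≡ v)
  bump-cases g u v h z w with z ≟V u | w ≟V v
  ... | yes z≡u | yes w≡v = inj₂ (z≡u , w≡v)
  ... | yes _   | no _    = inj₁ refl
  ... | no _    | _       = inj₁ refl

  row-sum-decrease : ∀ {F F' : V → V → ℕ} {u v} → F' u v + 1 ≡ F u v →
                     (∀ z w → z ≢ u ⊎ w ≢ v → F' z w ≡ F z w) →
                     ∀ z → sumV (F' z) + δ u z ≡ sumV (F z)
  row-sum-decrease {F} {F'} {u} {v} at-uv off z with z ≟V u
  ... | yes refl = begin
    sumV (F' u) + 1      ≡⟨ sum-map-update allV-unique (∈-allV v) (trans at-uv (sym (+-identityʳ _)))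
                                            (λ w w≢v → off u w (inj₂ w≢v)) ⟩
    sumV (F u) + 0       ≡⟨ +-identityʳ _ ⟩
    sumV (F u)           ∎
    where open ≡-Reasoning
  ... | no z≢u = begin
    sumV (F' z) + 0      ≡⟨ +-identityʳ _ ⟩
    sumV (F' z)          ≡⟨ cong sum (map-cong (λ w → off z w (inj₁ z≢u)) allV) ⟩
    sumV (F z)           ∎
    where open ≡-Reasoning

  bump-pred-+1 : ∀ g u v → 0 < g u v → bump g u v pred u v + 1 ≡ g u v
  bump-pred-+1 g u v pos =
    trans (cong (_+ 1) (bump-≡ g u v pred)) (trans (+-comm _ 1) (suc-pred (g u v) {{>-nonZero pos}}))

  bump-suc : ∀ g u v → g u v + 1 ≡ bump g u v suc u v
  bump-suc g u v = trans (+-comm _ 1) (sym (bump-≡ g u v suc))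

  outflow-decrease : ∀ g u v → 0 < g u v → ∀ z → outflow (bump g u v pred) z + δ u z ≡ outflow g z
  outflow-decrease g u v pos = row-sum-decrease {F = g} (bump-pred-+1 g u v pos) (λ _ _ → bump-≢)

  inflow-decrease : ∀ g u v → 0 < g u v → ∀ z → inflow (bump g u v pred) z + δ v z ≡ inflow g z
  inflow-decrease g u v pos =
    row-sum-decrease {F = flip g} (bump-pred-+1 g u v pos) (λ _ _ → bump-≢ ∘ Sum.swap)

  outflow-increase : ∀ g u v z → outflow g z + δ u z ≡ outflow (bump g u v suc) z
  outflow-increase g u v = row-sum-decrease {F' = g} (bump-suc g u v) (λ _ _ → sym ∘ bump-≢)

  inflow-increase : ∀ g u v z → inflow g z + δ v z ≡ inflow (bump g u v suc) z
  inflow-increase g u v =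
    row-sum-decrease {F' = flip g} (bump-suc g u v) (λ _ _ → sym ∘ bump-≢ ∘ Sum.swap)

  deficit-forward : ∀ {g i j} → 0 < g i j → Deficit g i → Deficit (bump g i j pred) j
  deficit-forward {g} {i} {j} pos deficit w w≢s w≢t = +-cancelʳ-≡ (δ i w) _ _ (begin
    outflow g' w + δ i w         ≡⟨ outflow-decrease g i j pos w ⟩
    outflow g w                  ≡⟨ deficit w w≢s w≢t ⟩
    inflow g w + δ i w           ≡⟨ cong (_+ δ i w) (inflow-decrease g i j pos w) ⟨
    inflow g' w + δ j w + δ i w  ∎)
    where
    open ≡-Reasoning
    g' = bump g i j pred

  deficit-backward : ∀ {g i j} → Deficit g i → Deficit (bump g j i suc) j
  deficit-backward {g} {i} {j} deficit w w≢s w≢t = begin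
    outflow g' w                 ≡⟨ outflow-increase g j i w ⟨
    outflow g w + δ j w          ≡⟨ cong (_+ δ j w) (deficit w w≢s w≢t) ⟩
    inflow g w + δ i w + δ j w   ≡⟨ cong (_+ δ j w) (inflow-increase g j i w) ⟩
    inflow g' w + δ j w          ∎
    where
    open ≡-Reasoning
    g' = bump g j i suc

  Tight : Potential → V → V → Set
  Tight π u v = IsEdge u v × π v ≡ π u + a u v

  bump-changes-only-tight : ∀ {π g i j h z w m} → Tight π i j →
                            m ≡ bump g i j h z w ⊎ Tight π z w → m ≡ g z w ⊎ Tight π z w
  bump-changes-only-tight _ (inj₂ tight) = inj₂ tight
  bump-changes-only-tight {g = g} {i} {j} {h} {z} {w} tight-ij (inj₁ m≡) with bump-cases g i j h z w
  ... | inj₁ unchanged   = inj₁ (trans m≡ unchanged)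
  ... | inj₂ (refl , refl) = inj₂ tight-ij

  augment-changes-only-tight : ∀ {f π z u} (M : Star (G' f π) z u) g v w →
                               augment g M v w ≡ g v w ⊎ Tight π v w
  augment-changes-only-tight ε g v w = inj₁ refl
  augment-changes-only-tight (_◅_ {i} {j} (inj₁ (e , tight , _)) M) g v w =
    bump-changes-only-tight {g = g} {i} {j} {pred} (e , tight) (augment-changes-only-tight M _ v w)
  augment-changes-only-tight (_◅_ {i} {j} (inj₂ (e , tight , _)) M) g v w =
    bump-changes-only-tight {g = g} {j} {i} {suc} (e , tight) (augment-changes-only-tight M _ v w)

  head∈vertices : ∀ {R : V → V → Set} {z u} (M : Star R z u) → z ∈ vertices M
  head∈vertices ε       = here refl
  head∈vertices (_ ◅ _) = here refl

  augment-deficit : ∀ {f π z} (M : Star (G' f π) z t) {g} → Unique (vertices M) →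
                    (∀ {u v} → u ∈ vertices M → v ∈ vertices M → g u v ≡ f u v) →
                    Deficit g z → Deficit (augment g M) t
  augment-deficit ε _ _ deficit = deficit
  augment-deficit {f} (_◅_ {i} {j} (inj₁ (_ , _ , f-ij>0)) M) {g} (i∉M ∷ M!) agree deficit =
    augment-deficit M M! agree' (deficit-forward g-ij>0 deficit)
    where
    g-ij>0 : 0 < g i j
    g-ij>0 = subst (0 <_) (sym (agree (here refl) (there (head∈vertices M)))) f-ij>0
    agree' : ∀ {u v} → u ∈ vertices M → v ∈ vertices M → bump g i j pred u v ≡ f u v
    agree' u∈M v∈M =
      trans (bump-≢ {g} {i} {j} {pred} (inj₁ (≢-sym (All.lookup i∉M u∈M)))) (agree (there u∈M) (there v∈M))
  augment-deficit {f} (_◅_ {i} {j} (inj₂ _) M) {g} (i∉M ∷ M!) agree deficit =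
    augment-deficit M M! agree' (deficit-backward deficit)
    where
    agree' : ∀ {u v} → u ∈ vertices M → v ∈ vertices M → bump g j i suc u v ≡ f u v
    agree' u∈M v∈M =
      trans (bump-≢ {g} {j} {i} {suc} (inj₂ (≢-sym (All.lookup i∉M v∈M)))) (agree (there u∈M) (there v∈M))

  module _ {f f' : Flow} {π : Potential} (change : ∀ u v → f' u v ≡ f u v ⊎ Tight π u v) where

    conditions-under-tight-change : ∀ {p} → Conditions f π p → Conditions f' π p
    conditions-under-tight-change (bounded , forward , backward) = bounded , forward' , backward'
      where
      forward' : ∀ u v → IsEdge u v → f' u v ≡ 1 → π u + a u v ≤ π v
      forward' u v e f'-uv≡1 with change u v
      ... | inj₁ unchanged = forward u v e (trans (sym unchanged) f'-uv≡1)
      ... | inj₂ (_ , tight) = ≤-reflexive (sym tight)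
      backward' : ∀ u v → IsEdge u v → f' u v ≡ 0 → π v ≤ π u + a u v
      backward' u v e f'-uv≡0 with change u v
      ... | inj₁ unchanged = backward u v e (trans (sym unchanged) f'-uv≡0)
      ... | inj₂ (_ , tight) = ≤-reflexive tight

    supported-under-tight-change : Supported f → Supported f'
    supported-under-tight-change supported u v ¬e with change u v
    ... | inj₁ unchanged = trans unchanged (supported u v ¬e)
    ... | inj₂ (e , _)   = ⊥-elim (¬e e)

  record Invariant (f : Flow) (π : Potential) (p : ℕ) : Set where
    field
      conditions : Conditions f π p
      π-s≡0      : π s ≡ 0
      π-t≡p      : π t ≡ p
      supported  : Supported f
      conserved  : Conserved f

  augment-invariant : ∀ {f π p} → Invariant f π p → (M : Star (G' f π) s t) → Unique (vertices M) →
                      Invariant (augment f M) π p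
  augment-invariant {f} inv M M! = record
    { conditions = conditions-under-tight-change change conditions
    ; π-s≡0      = π-s≡0
    ; π-t≡p      = π-t≡p
    ; supported  = supported-under-tight-change change supported
    ; conserved  = Deficit-t⇒Conserved {augment f M}
                     (augment-deficit M M! (λ _ _ → refl) (Conserved⇒Deficit-s {f} conserved))
    }
    where
    open Invariant inv
    change = augment-changes-only-tight M f

  reset≡⊓ : ∀ {p k} → k ≤ suc p → reset p k ≡ k ⊓ p
  reset≡⊓ {p} {k} k≤1+p = by-cases (k ≟ suc p)
    where
    by-cases : (k≟1+p : Dec (k ≡ suc p)) → (if does k≟1+p then p else k) ≡ k ⊓ p
    by-cases (yes refl)   = sym (m≥n⇒m⊓n≡n (n≤1+n p))
    by-cases (no k≢1+p)   = sym (m≤n⇒m⊓n≡m (≤-pred (≤∧≢⇒< k≤1+p k≢1+p)))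

  module _ {f : Flow} (supported : Supported f) where

    no-flow-off-edges : ∀ {u v} → ¬ IsEdge u v → ¬ 0 < f u v
    no-flow-off-edges {u} {v} ¬e pos = n≮0 (subst (0 <_) (supported u v ¬e) pos)

    inflow-of-x-from-s : ∀ {q} → 0 < inflow f (x q) → 0 < f s (x q)
    inflow-of-x-from-s {q} pos with satisfied (sum-map-pos {φ = λ u → f u (x q)} allV pos)
    ... | s   , pos' = pos'
    ... | t   , pos' = ⊥-elim (no-flow-off-edges (λ ()) pos')
    ... | x _ , pos' = ⊥-elim (no-flow-off-edges (λ ()) pos')
    ... | y _ , pos' = ⊥-elim (no-flow-off-edges (λ ()) pos')

    outflow-of-y-to-t : ∀ {q} → 0 < outflow f (y q) → 0 < f (y q) t
    outflow-of-y-to-t {q} pos with satisfied (sum-map-pos {φ = f (y q)} allV pos)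
    ... | t   , pos' = pos'
    ... | s   , pos' = ⊥-elim (no-flow-off-edges (λ ()) pos')
    ... | x _ , pos' = ⊥-elim (no-flow-off-edges (λ ()) pos')
    ... | y _ , pos' = ⊥-elim (no-flow-off-edges (λ ()) pos')

  flow-through-costly-edge : ∀ {f π p z w} → Invariant f π p → IsEdge z w → 0 < a z w → 0 < f z w →
                     (π z ≡ 0 → G' f π s z) × (π w ≡ p → G' f π w t)
  flow-through-costly-edge {f} {π} inv (xy {q} {q'} _) _ pos = from-s , to-t
    where
    open Invariant inv
    inflow-x>0 : 0 < inflow f (x q)
    inflow-x>0 = subst (0 <_) (sym (conserved (x q) (λ ()) (λ ())))
                       (<-≤-trans pos (∈⇒≤sum-map {φ = f (x q)} (∈-allV (y q'))))
    outflow-y>0 : 0 < outflow f (y q')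
    outflow-y>0 = subst (0 <_) (conserved (y q') (λ ()) (λ ()))
                        (<-≤-trans pos (∈⇒≤sum-map {φ = flip f (y q')} (∈-allV (x q))))
    from-s : π (x q) ≡ 0 → G' f π s (x q)
    from-s πx≡0 = inj₁ (sx q , trans πx≡0 (sym (trans (+-identityʳ _) π-s≡0)) ,
                        inflow-of-x-from-s supported inflow-x>0)
    to-t : π (y q') ≡ _ → G' f π (y q') t
    to-t πy≡p = inj₁ (yt q' , trans π-t≡p (sym (trans (+-identityʳ _) πy≡p)) ,
                      outflow-of-y-to-t supported outflow-y>0)

  module _ {f π P} (inv : Invariant f π (suc P)) (X : V → Bool)
           (X⇔reachable : ∀ z → (X z ≡ true) ⇔ Star (G' f π) s z) (X-t : X t ≡ false) where
    open Invariant inv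
    open Equivalence

    private
      bounded = proj₁ conditions
      forward = proj₁ (proj₂ conditions)
      backward = proj₂ (proj₂ conditions)

    X-s : X s ≡ true
    X-s = from (X⇔reachable s) ε

    no-G'-edge-leaving-X : ∀ {u v} → X u ≡ true → X v ≡ false → ¬ G' f π u v
    no-G'-edge-leaving-X {u} {v} X-u X-v uv
      with trans (sym (from (X⇔reachable v) (to (X⇔reachable u) X-u ◅◅ (uv ◅ ε)))) X-v
    ... | ()

    lowered : V → ℕ
    lowered z = lowerUnless (X z) (π z)

    lower≡⊓ : ∀ z → lower X π P z ≡ lowered z ⊓ P
    lower≡⊓ z = reset≡⊓ (≤-trans (lowerUnless-≤ (X z) (π z)) (bounded z))

    lower-forward : ∀ z w → IsEdge z w → f z w ≡ 1 → lower X π P z + a z w ≤ lower X π P w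
    lower-forward z w e f-zw≡1 = begin
      lower X π P z + a z w  ≡⟨ cong (_+ a z w) (lower≡⊓ z) ⟩
      lowered z ⊓ P + a z w  ≤⟨ m+c≤n⇒m⊓p+c≤n⊓p {lowered z} {lowered w} P lowered-forward bound ⟩
      lowered w ⊓ P          ≡⟨ lower≡⊓ w ⟨
      lower X π P w          ∎
      where
      open ≤-Reasoning
      f-zw>0 : 0 < f z w
      f-zw>0 = subst (0 <_) (sym f-zw≡1) z<s
      not-tight : X z ≡ true → X w ≡ false → π z + a z w < π w
      not-tight X-z X-w = ≤∧≢⇒< (forward z w e f-zw≡1)
        λ tight → no-G'-edge-leaving-X X-z X-w (inj₁ (e , sym tight , f-zw>0))
      nonzero : X z ≡ false → 0 < a z w → 0 < π z
      nonzero X-z costly = n≢0⇒n>0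
        λ πz≡0 → no-G'-edge-leaving-X X-s X-z (proj₁ (flow-through-costly-edge inv e costly f-zw>0) πz≡0)
      lowered-forward : lowered z + a z w ≤ lowered w
      lowered-forward = lowerUnless-preserves-+≤ (X z) (X w) (forward z w e f-zw≡1) not-tight nonzero
      bound : 0 < a z w → lowered w ≤ P
      bound costly = lowerUnless-≤-pred (X w) (bounded w)
        λ X-w πw≡1+P → no-G'-edge-leaving-X X-w X-t (proj₂ (flow-through-costly-edge inv e costly f-zw>0) πw≡1+P)

    lower-backward : ∀ z w → IsEdge z w → f z w ≡ 0 → lower X π P w ≤ lower X π P z + a z w
    lower-backward z w e f-zw≡0 = begin
      lower X π P w          ≡⟨ lower≡⊓ w ⟩
      lowered w ⊓ P          ≤⟨ n≤m+c⇒n⊓p≤m⊓p+c {lowered z} {lowered w} P lowered-backward ⟩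
      lowered z ⊓ P + a z w  ≡⟨ cong (_+ a z w) (lower≡⊓ z) ⟨
      lower X π P z + a z w  ∎
      where
      open ≤-Reasoning
      not-tight : X w ≡ true → X z ≡ false → π w < π z + a z w
      not-tight X-w X-z = ≤∧≢⇒< (backward z w e f-zw≡0)
        λ tight → no-G'-edge-leaving-X X-w X-z (inj₂ (e , tight , subst (_< 1) (sym f-zw≡0) z<s))
      lowered-backward : lowered w ≤ lowered z + a z w
      lowered-backward = lowerUnless-preserves-≤+ (X z) (X w) (backward z w e f-zw≡0) not-tight

    lower-invariant : Invariant f (lower X π P) P
    lower-invariant = record
      { conditions = (λ z → subst (_≤ P) (sym (lower≡⊓ z)) (m⊓n≤n _ P)) , lower-forward , lower-backward
      ; π-s≡0      = trans (lower≡⊓ s) (cong₂ (λ b k → lowerUnless b k ⊓ P) X-s π-s≡0)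
      ; π-t≡p      = trans (lower≡⊓ t)
                       (trans (cong₂ (λ b k → lowerUnless b k ⊓ P) X-t π-t≡p) (⊓-idem P))
      ; supported  = supported
      ; conserved  = conserved
      }

  Invariantₛ : State → Set
  Invariantₛ ⟨ f , π , p , _ ⟩ = Invariant f π p

  step-invariant : ∀ {st st'} → Step st st' → Invariantₛ st → Invariantₛ st'
  step-invariant (step2a _ _ M M!) inv = augment-invariant inv M M!
  step-invariant (step2b {p = suc _} _ _ X X⇔reachable X-t) inv =
    lower-invariant inv X X⇔reachable X-t

  run-invariant : ∀ {st st'} → Run st st' → Invariantₛ st → Invariantₛ st'
  run-invariant ε            = id
  run-invariant (step ◅ run) = run-invariant run ∘ step-invariant step

lemma9p3 : (n : ℕ) (_≼_ : Fin n → Fin n → Set) → IsPartialOrder _≡_ _≼_ →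
    (f₀ : Frank.Flow n _≼_) (π₀ : Frank.Potential n _≼_) →
    Frank.IsFlow n _≼_ f₀ → Frank.IsPotential n _≼_ π₀ →
    Frank.Conditions n _≼_ f₀ π₀ (π₀ (Frank.t)) →
    (st : Frank.State n _≼_) →
    Frank.Run n _≼_ (Frank.⟨_,_,_,_⟩ f₀ π₀ (π₀ Frank.t) (Frank.value n _≼_ f₀)) st →
    Frank.Conditions n _≼_ (Frank.State.flow st) (Frank.State.pot st) (Frank.State.pval st)
lemma9p3 n _≼_ _ f₀ π₀ (supported , _ , conserved) π₀-s≡0 conditions st run =
  Invariant.conditions (run-invariant run initial)
  where
  open Invariance n _≼_
  initial : Invariant f₀ π₀ (π₀ Frank.t)
  initial = record
    { conditions = conditions
    ; π-s≡0      = π₀-s≡0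
    ; π-t≡p      = refl
    ; supported  = supported
    ; conserved  = conserved
    }
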